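{- Let $G$ be a finite simple graph and let $H$ be the skeleton of $G$. If $\chi(H)\le 3$, then $\chi(G)\le\frac{3}{2}\omega(G)$.
   Context: Two vertices $u,v$ are twins if they are adjacent and have the same neighbours in $V(G)\setminus\{u,v\}$; this is an equivalence relation partitioning $V(G)$ into classes $T_1,\dots,T_r$. The skeleton of $G$ is the subgraph induced by a set of $r$ vertices, one from each class $T_i$. $\chi$ is the chromatic number and $\omega$ the clique number. -}

module Defs where

open import Data.Nat using (ℕ; _≤_; _*_)
open import Data.Fin using (Fin)
open import Data.Bool using (Bool; true; false)
open import Data.Product using (Σ; _×_; ∃)
open import Data.Sum using (_⊎_)
open import Relation.Binary.PropositionalEquality using (_≡_; _≢_)
open import Relation.Nullary using (¬_)
open import Function.Definitions using (Injective)

record Graph (n : ℕ) : Set where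
  field
    adj   : Fin n → Fin n → Bool
    sym   : ∀ u v → adj u v ≡ adj v u
    irrefl : ∀ u → adj u u ≡ false

open Graph public

Adj : ∀ {n} → Graph n → Fin n → Fin n → Set
Adj G u v = adj G u v ≡ true

Twins : ∀ {n} → Graph n → Fin n → Fin n → Set
Twins G u v = u ≢ v × Adj G u v ×
  (∀ w → w ≢ u → w ≢ v → adj G u w ≡ adj G v w)

TwinEq : ∀ {n} → Graph n → Fin n → Fin n → Set
TwinEq G u v = u ≡ v ⊎ Twins G u v

record SkeletonChoice {n} (G : Graph n) (r : ℕ) : Set where
  field
    rep      : Fin r → Fin n
    covers   : ∀ v → ∃ λ i → TwinEq G v (rep i)
    distinct : ∀ i j → TwinEq G (rep i) (rep j) → i ≡ j

open SkeletonChoice public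

induced : ∀ {n r} (G : Graph n) (f : Fin r → Fin n) → Graph r
induced G f = record
  { adj = λ i j → adj G (f i) (f j)
  ; sym = λ i j → sym G (f i) (f j)
  ; irrefl = λ i → irrefl G (f i) }

skeleton : ∀ {n r} (G : Graph n) → SkeletonChoice G r → Graph r
skeleton G S = induced G (rep S)

ProperColouring : ∀ {n} → Graph n → (k : ℕ) → (Fin n → Fin k) → Set
ProperColouring G k c = ∀ u v → Adj G u v → c u ≢ c v

Colourable : ∀ {n} → Graph n → ℕ → Set
Colourable {n} G k = Σ (Fin n → Fin k) (ProperColouring G k)

IsClique : ∀ {n m} → Graph n → (Fin m → Fin n) → Set
IsClique G f = Injective _≡_ _≡_ f × (∀ i j → i ≢ j → Adj G (f i) (f j))

HasClique : ∀ {n} → Graph n → ℕ → Set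
HasClique {n} G m = Σ (Fin m → Fin n) (IsClique G)

CliqueNumber : ∀ {n} → Graph n → ℕ → Set
CliqueNumber G ω = HasClique G ω × (∀ m → HasClique G m → m ≤ ω)

-- The twin classes of G are cliques, and two of them are complete to each other when their
-- representatives are adjacent in the skeleton H and anticomplete otherwise. So a class has at
-- most ω vertices, and two classes adjacent in H have at most ω vertices together.
-- Fix a proper 3-colouring of H and number the vertices of each class 0, 1, …. A vertex at
-- position q of a class of H-colour X gets colour (X, q) if q lies in the lower half of
-- 0 … ω-1, colour (X+1, ω-1-q) if it lies in the upper half, and one extra colour if it is the
-- centre: 3⌊ω/2⌋ + (ω mod 2) ≤ 3ω/2 colours in all. Within a class the colours are distinct.
-- For adjacent classes (X ≠ Y, positions with q + q' ≤ ω - 2) at most one of q, q' reaches the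
-- centre, and (X, q) = (Y+1, ω-1-q') would force q + q' = ω - 1.
module Submission where

open import Defs hiding (sym)
open import Data.Empty using (⊥)
open import Data.Fin using (Fin; zero; suc; toℕ; fromℕ<; join; splitAt; combine; _≟_)
open import Data.Fin.Properties
  using (splitAt-join; combine-injectiveˡ; combine-injectiveʳ; fromℕ<-injective; toℕ-injective; toℕ<n)
open import Data.List using (List; length; filter; allFin; lookup; _++_)
open import Data.List.Properties using (length-++)
open import Data.List.Membership.Propositional using (_∈_)
open import Data.List.Membership.Propositional.Properties
  using (∈-filter⁺; ∈-filter⁻; ∈-allFin; ∈-lookup; ∈-++⁻)
open import Data.List.Relation.Unary.All as All using ()
open import Data.List.Relation.Unary.AllPairs using (_∷_)
open import Data.List.Relation.Unary.Any using (index)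
open import Data.List.Relation.Unary.Any.Properties using (lookup-index)
open import Data.List.Relation.Unary.Unique.Propositional using (Unique)
open import Data.List.Relation.Unary.Unique.Propositional.Properties using (filter⁺; allFin⁺; ++⁺)
open import Data.Nat using (ℕ; suc; _+_; _*_; _∸_; _/_; _%_; _≤_; _<_)
open import Data.Nat.DivMod using (m≡m%n+[m/n]*n; [m+kn]%n≡m%n; m*n/n≡m; /-monoˡ-≤)
open import Data.Nat.Properties
  using ( <-cmp; suc-injective; +-comm; +-suc; *-cancelʳ-≡; ∸-cancelˡ-≡; m+[n∸m]≡n; m+n≤o⇒m≤o∸n
        ; m≤m+n; ≤-reflexive; ≤-trans; <-≤-trans; <⇒≤; <⇒≢; <-asym; +-mono-≤; +-monoˡ-≤; +-monoʳ-≤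
        ; module ≤-Reasoning )
open import Data.Nat.Tactic.RingSolver using (solve-∀)
open import Data.Product using (Σ; _×_; _,_; proj₁; proj₂)
open import Data.Sum as Sum using (_⊎_; inj₁; inj₂)
open import Data.Sum.Properties using (inj₁-injective)
open import Function using (_∘_)
open import Relation.Binary.Definitions using (tri<; tri≈; tri>)
open import Relation.Binary.PropositionalEquality
open import Relation.Nullary using (¬_; yes; no)
open import Relation.Nullary.Negation using (contradiction)

join-injective : ∀ m n {x y : Fin m ⊎ Fin n} → join m n x ≡ join m n y → x ≡ y
join-injective m n {x} {y} eq =
  trans (sym (splitAt-join m n x)) (trans (cong (splitAt m) eq) (splitAt-join m n y))

Unique⇒lookup-injective : ∀ {A : Set} {xs : List A} → Unique xs →
                          ∀ {i j} → lookup xs i ≡ lookup xs j → i ≡ j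
Unique⇒lookup-injective (_ ∷ _) {zero} {zero} _ = refl
Unique⇒lookup-injective (x∉ ∷ _) {zero} {suc j} eq = contradiction eq (All.lookup x∉ (∈-lookup j))
Unique⇒lookup-injective (x∉ ∷ _) {suc i} {zero} eq = contradiction (sym eq) (All.lookup x∉ (∈-lookup i))
Unique⇒lookup-injective (_ ∷ unique) {suc i} {suc j} eq = cong suc (Unique⇒lookup-injective unique eq)

toℕ-index-injective : ∀ {A : Set} {xs ys : List A} {x y} (x∈ : x ∈ xs) (y∈ : y ∈ ys) →
                      xs ≡ ys → toℕ (index x∈) ≡ toℕ (index y∈) → x ≡ y
toℕ-index-injective {xs = xs} x∈ y∈ refl eq =
  trans (lookup-index x∈) (trans (cong (lookup xs) (toℕ-injective eq)) (sym (lookup-index y∈)))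

module _ {n} (G : Graph n) where

  Adj-irrefl : ∀ u → ¬ Adj G u u
  Adj-irrefl u a with () ← trans (sym a) (irrefl G u)

  Adj⇒≢ : ∀ {u v} → Adj G u v → u ≢ v
  Adj⇒≢ {u} a refl = Adj-irrefl u a

  Adj-sym : ∀ {u v} → Adj G u v → Adj G v u
  Adj-sym {u} {v} a = trans (Graph.sym G v u) a

  twinEq-adj-≡ : ∀ {u a b} → TwinEq G u a → u ≢ b → a ≢ b → adj G u b ≡ adj G a b
  twinEq-adj-≡ (inj₁ refl)          _   _   = refl
  twinEq-adj-≡ (inj₂ (_ , _ , same)) u≢b a≢b = same _ (u≢b ∘ sym) (a≢b ∘ sym)

  twinEq⇒Adj : ∀ {u v a} → TwinEq G u a → TwinEq G v a → u ≢ v → Adj G u v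
  twinEq⇒Adj (inj₁ refl)          (inj₁ refl)             u≢v = contradiction refl u≢v
  twinEq⇒Adj (inj₁ refl)          (inj₂ (_ , va , _))     _   = Adj-sym va
  twinEq⇒Adj (inj₂ (_ , ua , _))  (inj₁ refl)             _   = ua
  twinEq⇒Adj (inj₂ (_ , _ , same)) (inj₂ (v≢a , va , _)) u≢v =
    trans (same _ (u≢v ∘ sym) v≢a) (Adj-sym va)

  clique-fromList : (ys : List (Fin n)) → Unique ys →
                    (∀ {x y} → x ∈ ys → y ∈ ys → x ≢ y → Adj G x y) → HasClique G (length ys)
  clique-fromList ys unique adjacent =
    lookup ys , Unique⇒lookup-injective unique , λ i j i≢j →
      adjacent (∈-lookup i) (∈-lookup j) (i≢j ∘ Unique⇒lookup-injective unique)

module TwinClasses {n r} (G : Graph n) (S : SkeletonChoice G r) where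

  H : Graph r
  H = skeleton G S

  class : Fin n → Fin r
  class v = proj₁ (covers S v)

  twinEq-rep : ∀ v → TwinEq G v (rep S (class v))
  twinEq-rep v = proj₂ (covers S v)

  class-rep : ∀ i → class (rep S i) ≡ i
  class-rep i = sym (distinct S i (class (rep S i)) (twinEq-rep (rep S i)))

  adj-sameClass : ∀ {u v} → class u ≡ class v → u ≢ v → Adj G u v
  adj-sameClass {u} {v} same =
    twinEq⇒Adj G (twinEq-rep u) (subst (λ i → TwinEq G v (rep S i)) (sym same) (twinEq-rep v))

  adj-differentClass : ∀ {u v} → class u ≢ class v → adj G u v ≡ adj H (class u) (class v)
  adj-differentClass {u} {v} differ = begin
    adj G u v  ≡⟨ Graph.sym G u v ⟩
    adj G v u  ≡⟨ twinEq-adj-≡ G (twinEq-rep v) (differ ∘ cong class ∘ sym) (u≢b ∘ sym) ⟩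
    adj G b u  ≡⟨ Graph.sym G b u ⟩
    adj G u b  ≡⟨ twinEq-adj-≡ G (twinEq-rep u) u≢b (differ ∘ distinct S _ _ ∘ inj₁) ⟩
    adj G a b  ∎
    where
    open ≡-Reasoning
    a = rep S (class u)
    b = rep S (class v)
    u≢b : u ≢ b
    u≢b u≡b = differ (trans (cong class u≡b) (class-rep (class v)))

  Adj⇒Adj-skeleton : ∀ {u v} → Adj G u v → class u ≢ class v → Adj H (class u) (class v)
  Adj⇒Adj-skeleton uv differ = trans (sym (adj-differentClass differ)) uv

  sameOrAdjacentClass⇒Adj : ∀ {u v} → class u ≡ class v ⊎ Adj H (class u) (class v) → u ≢ v → Adj G u v
  sameOrAdjacentClass⇒Adj (inj₁ same) = adj-sameClass same
  sameOrAdjacentClass⇒Adj {u} {v} (inj₂ classes-adj) with class u ≟ class v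
  ... | yes same   = adj-sameClass same
  ... | no  differ = λ _ → trans (adj-differentClass differ) classes-adj

  members : Fin r → List (Fin n)
  members i = filter (λ v → class v ≟ i) (allFin n)

  size : Fin r → ℕ
  size i = length (members i)

  ∈-members : ∀ v → v ∈ members (class v)
  ∈-members v = ∈-filter⁺ (λ w → class w ≟ class v) (∈-allFin v) refl

  ∈-members⁻ : ∀ {i v} → v ∈ members i → class v ≡ i
  ∈-members⁻ {i} v∈ = proj₂ (∈-filter⁻ (λ w → class w ≟ i) {xs = allFin n} v∈)

  members-unique : ∀ i → Unique (members i)
  members-unique i = filter⁺ (λ w → class w ≟ i) (allFin⁺ n)

  position : Fin n → ℕ
  position v = toℕ (index (∈-members v))

  position<size : ∀ v → position v < size (class v)
  position<size v = toℕ<n (index (∈-members v))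

  position-injective : ∀ {u v} → class u ≡ class v → position u ≡ position v → u ≡ v
  position-injective {u} {v} same =
    toℕ-index-injective (∈-members u) (∈-members v) (cong members same)

  module _ {ω} (ω-max : ∀ m → HasClique G m → m ≤ ω) where

    size≤ω : ∀ i → size i ≤ ω
    size≤ω i = ω-max _ (clique-fromList G (members i) (members-unique i) λ u∈ v∈ →
      adj-sameClass (trans (∈-members⁻ u∈) (sym (∈-members⁻ v∈))))

    size+size≤ω : ∀ {i j} → Adj H i j → size i + size j ≤ ω
    size+size≤ω {i} {j} i~j = subst (_≤ ω) (length-++ (members i))
      (ω-max _ (clique-fromList G (members i ++ members j)
                  (++⁺ (members-unique i) (members-unique j) disjoint)
                  (λ u∈ v∈ → sameOrAdjacentClass⇒Adj (sameOrAdjacent (class-∈ u∈) (class-∈ v∈)))))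
      where
      disjoint : ∀ {v} → ¬ (v ∈ members i × v ∈ members j)
      disjoint (v∈i , v∈j) = Adj⇒≢ H i~j (trans (sym (∈-members⁻ v∈i)) (∈-members⁻ v∈j))

      class-∈ : ∀ {v} → v ∈ members i ++ members j → class v ≡ i ⊎ class v ≡ j
      class-∈ v∈ = Sum.map ∈-members⁻ ∈-members⁻ (∈-++⁻ (members i) v∈)

      sameOrAdjacent : ∀ {u v} → class u ≡ i ⊎ class u ≡ j → class v ≡ i ⊎ class v ≡ j →
             class u ≡ class v ⊎ Adj H (class u) (class v)
      sameOrAdjacent (inj₁ refl) (inj₁ v∈i)  = inj₁ (sym v∈i)
      sameOrAdjacent (inj₁ refl) (inj₂ refl) = inj₂ i~j
      sameOrAdjacent (inj₂ refl) (inj₁ refl) = inj₂ (Adj-sym H i~j)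
      sameOrAdjacent (inj₂ refl) (inj₂ v∈j)  = inj₁ (sym v∈j)

m*2≡m+m : ∀ m → m * 2 ≡ m + m
m*2≡m+m = solve-∀

next : Fin 3 → Fin 3
next zero = suc zero
next (suc zero) = suc (suc zero)
next (suc (suc zero)) = zero

next-≢ : ∀ X → X ≢ next X
next-≢ zero ()
next-≢ (suc zero) ()
next-≢ (suc (suc zero)) ()

module MirrorSlots (ω : ℕ) where

  mirror : ℕ → ℕ
  mirror q = ω ∸ suc q

  suc+mirror≡ω : ∀ {q} → q < ω → suc q + mirror q ≡ ω
  suc+mirror≡ω = m+[n∸m]≡n

  <-mirror : ∀ {q q'} → suc q + suc q' ≤ ω → q < mirror q'
  <-mirror {q} = m+n≤o⇒m≤o∸n (suc q)

  <-mirror′ : ∀ {q q'} → suc q + suc q' ≤ ω → q' < mirror q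
  <-mirror′ {q} {q'} h = <-mirror (subst (_≤ ω) (+-comm (suc q) (suc q')) h)

  mirror-fixed⇒odd : ∀ {q} → q < ω → q ≡ mirror q → suc (q * 2) ≡ ω
  mirror-fixed⇒odd {q} q<ω q≡m = begin
    suc (q * 2)        ≡⟨ cong suc (m*2≡m+m q) ⟩
    suc q + q          ≡⟨ cong (suc q +_) q≡m ⟩
    suc q + mirror q   ≡⟨ suc+mirror≡ω q<ω ⟩
    ω                  ∎
    where open ≡-Reasoning

  data Colour : Set where
    palette : Fin 3 → ℕ → Colour
    middle  : Colour

  palette-injectiveˡ : ∀ {X Y s t} → palette X s ≡ palette Y t → X ≡ Y
  palette-injectiveˡ refl = refl

  palette-injectiveʳ : ∀ {X Y s t} → palette X s ≡ palette Y t → s ≡ t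
  palette-injectiveʳ refl = refl

  slot : Fin 3 → ℕ → Colour
  slot X q with <-cmp q (mirror q)
  ... | tri< _ _ _ = palette X q
  ... | tri≈ _ _ _ = middle
  ... | tri> _ _ _ = palette (next X) (mirror q)

  slot-injective : ∀ {X q q'} → q < ω → q' < ω → slot X q ≡ slot X q' → q ≡ q'
  slot-injective {X} {q} {q'} q<ω q'<ω eq with <-cmp q (mirror q) | <-cmp q' (mirror q')
  ... | tri< _ _ _ | tri< _ _ _ = palette-injectiveʳ eq
  ... | tri< _ _ _ | tri≈ _ _ _ with () ← eq
  ... | tri< _ _ _ | tri> _ _ _ = contradiction (palette-injectiveˡ eq) (next-≢ X)
  ... | tri≈ _ _ _ | tri< _ _ _ with () ← eq
  ... | tri≈ _ q≡m _ | tri≈ _ q'≡m' _ =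
    *-cancelʳ-≡ q q' 2
      (suc-injective (trans (mirror-fixed⇒odd q<ω q≡m) (sym (mirror-fixed⇒odd q'<ω q'≡m'))))
  ... | tri≈ _ _ _ | tri> _ _ _ with () ← eq
  ... | tri> _ _ _ | tri< _ _ _ = contradiction (sym (palette-injectiveˡ eq)) (next-≢ X)
  ... | tri> _ _ _ | tri≈ _ _ _ with () ← eq
  ... | tri> _ _ _ | tri> _ _ _ = suc-injective (∸-cancelˡ-≡ q<ω q'<ω (palette-injectiveʳ eq))

  not-both-beyond-mirror : ∀ {q q'} → suc q + suc q' ≤ ω → mirror q ≤ q → mirror q' ≤ q' → ⊥
  not-both-beyond-mirror h m≤q m'≤q' =
    <-asym (<-≤-trans (<-mirror h) m'≤q') (<-≤-trans (<-mirror′ h) m≤q)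

  slot-separates : ∀ {X Y q q'} → X ≢ Y → suc q + suc q' ≤ ω → slot X q ≢ slot Y q'
  slot-separates {q = q} {q'} X≢Y h eq with <-cmp q (mirror q) | <-cmp q' (mirror q')
  ... | tri< _ _ _ | tri< _ _ _ = X≢Y (palette-injectiveˡ eq)
  ... | tri< _ _ _ | tri≈ _ _ _ with () ← eq
  ... | tri< _ _ _ | tri> _ _ _ = <⇒≢ (<-mirror h) (palette-injectiveʳ eq)
  ... | tri≈ _ _ _ | tri< _ _ _ with () ← eq
  ... | tri≈ _ q≡m _ | tri≈ _ q'≡m' _ =
    not-both-beyond-mirror h (≤-reflexive (sym q≡m)) (≤-reflexive (sym q'≡m'))
  ... | tri≈ _ _ _ | tri> _ _ _ with () ← eq
  ... | tri> _ _ _ | tri< _ _ _ = <⇒≢ (<-mirror′ h) (sym (palette-injectiveʳ eq))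
  ... | tri> _ _ _ | tri≈ _ _ _ with () ← eq
  ... | tri> _ _ m<q | tri> _ _ m'<q' = not-both-beyond-mirror h (<⇒≤ m<q) (<⇒≤ m'<q')

  colours : ℕ
  colours = 3 * (ω / 2) + ω % 2

  colours-bound : 2 * colours ≤ 3 * ω
  colours-bound = begin
    2 * (3 * h + e)      ≤⟨ m≤m+n (2 * (3 * h + e)) e ⟩
    2 * (3 * h + e) + e  ≡⟨ regroup h e ⟩
    3 * (e + h * 2)      ≡⟨ cong (3 *_) (m≡m%n+[m/n]*n ω 2) ⟨
    3 * ω                ∎
    where
    open ≤-Reasoning
    h = ω / 2
    e = ω % 2
    regroup : ∀ h e → 2 * (3 * h + e) + e ≡ 3 * (e + h * 2)
    regroup = solve-∀

  InRange : Colour → Set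
  InRange (palette _ s) = s < ω / 2
  InRange middle        = 0 < ω % 2

  code : (c : Colour) → InRange c → Fin (3 * (ω / 2)) ⊎ Fin (ω % 2)
  code (palette X s) s<h = inj₁ (combine X (fromℕ< s<h))
  code middle        0<e = inj₂ (fromℕ< 0<e)

  code-injective : ∀ c d (c∈ : InRange c) (d∈ : InRange d) → code c c∈ ≡ code d d∈ → c ≡ d
  code-injective (palette X s) (palette Y t) s<h t<h eq = cong₂ palette X≡Y s≡t
    where
    combine≡ : combine X (fromℕ< s<h) ≡ combine Y (fromℕ< t<h)
    combine≡ = inj₁-injective eq
    X≡Y : X ≡ Y
    X≡Y = combine-injectiveˡ X _ Y _ combine≡
    s≡t : s ≡ t
    s≡t = fromℕ<-injective s t s<h t<h (combine-injectiveʳ X _ Y _ combine≡)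
  code-injective (palette _ _) middle _ _ ()
  code-injective middle (palette _ _) _ _ ()
  code-injective middle middle _ _ _ = refl

  encode : (c : Colour) → InRange c → Fin colours
  encode c c∈ = join (3 * (ω / 2)) (ω % 2) (code c c∈)

  encode-injective : ∀ c d (c∈ : InRange c) (d∈ : InRange d) → encode c c∈ ≡ encode d d∈ → c ≡ d
  encode-injective c d c∈ d∈ eq =
    code-injective c d c∈ d∈ (join-injective (3 * (ω / 2)) (ω % 2) eq)

  below-half : ∀ {s} → suc s + suc s ≤ ω → s < ω / 2
  below-half {s} h = begin
    suc s              ≡⟨ m*n/n≡m (suc s) 2 ⟨
    suc s * 2 / 2      ≤⟨ /-monoˡ-≤ 2 (subst (_≤ ω) (sym (m*2≡m+m (suc s))) h) ⟩
    ω / 2              ∎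
    where open ≤-Reasoning

  slot-inRange : ∀ {X q} → q < ω → InRange (slot X q)
  slot-inRange {q = q} q<ω with <-cmp q (mirror q)
  ... | tri< q<m _ _ =
    below-half (≤-trans (+-monoʳ-≤ (suc q) q<m) (≤-reflexive (suc+mirror≡ω q<ω)))
  ... | tri≈ _ q≡m _ =
    subst (λ w → 0 < w % 2) (mirror-fixed⇒odd q<ω q≡m) (≤-reflexive (sym ([m+kn]%n≡m%n 1 q 2)))
  ... | tri> _ _ m<q =
    below-half (≤-trans (+-monoˡ-≤ (suc (mirror q)) m<q)
                        (≤-reflexive (trans (+-suc q (mirror q)) (suc+mirror≡ω q<ω))))

module SkeletonColouring {n r} (G : Graph n) (S : SkeletonChoice G r)
                         {ω} (ω-max : ∀ m → HasClique G m → m ≤ ω)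
                         (c : Fin r → Fin 3) (c-proper : ProperColouring (skeleton G S) 3 c) where

  open TwinClasses G S
  open MirrorSlots ω

  position<ω : ∀ v → position v < ω
  position<ω v = <-≤-trans (position<size v) (size≤ω ω-max (class v))

  paint : Fin n → Colour
  paint v = slot (c (class v)) (position v)

  paint-inRange : ∀ v → InRange (paint v)
  paint-inRange v = slot-inRange (position<ω v)

  paint-proper : ∀ u v → Adj G u v → paint u ≢ paint v
  paint-proper u v uv eq with class u ≟ class v
  ... | yes same = Adj⇒≢ G uv (position-injective same (slot-injective (position<ω u) (position<ω v) eq′))
    where
    eq′ : slot (c (class u)) (position u) ≡ slot (c (class u)) (position v)
    eq′ = trans eq (cong (λ i → slot (c i) (position v)) (sym same))
  ... | no differ = slot-separates (c-proper _ _ classes-adj) room eq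
    where
    classes-adj : Adj H (class u) (class v)
    classes-adj = Adj⇒Adj-skeleton uv differ
    room : suc (position u) + suc (position v) ≤ ω
    room = ≤-trans (+-mono-≤ (position<size u) (position<size v)) (size+size≤ω ω-max classes-adj)

lemma6 : ∀ {n r} (G : Graph n) (S : SkeletonChoice G r) (ω : ℕ) →
    Colourable (skeleton G S) 3 → CliqueNumber G ω →
    Σ ℕ (λ k → (2 * k ≤ 3 * ω) × Colourable G k)
lemma6 G S ω (c , c-proper) (_ , ω-max) =
  colours , colours-bound , (λ v → encode (paint v) (paint-inRange v)) ,
  λ u v uv eq → paint-proper u v uv (encode-injective _ _ _ _ eq)
  where
  open MirrorSlots ω
  open SkeletonColouring G S ω-max c c-proper
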